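{- Let $L$ be a finite lattice and $D$ a finite (arc-colored, directed) graph such that $\mathrm{End}(D)\cong(L,\wedge)$. Then $(L,\leq)\cong(\mathcal R_D,\subseteq)$ as posets. In particular, under this correspondence the meet $\wedge$ corresponds to intersection of retracts.
   Context: For a digraph with colored arcs $D=(V,\{A_c\})$, $\mathrm{End}(D)$ is the monoid under composition of maps $\varphi:V\to V$ preserving each arc set $A_c$ (for undirected graphs: edges to edges). An endomorphism $\varphi$ is a retraction if its restriction to its image is the identity. A retract is the (arc-colored, directed) subgraph induced by the image of a retraction; $\mathcal R_D$ is the set of retracts of $D$, ordered by inclusion. A lattice is regarded as the monoid $(L,\wedge)$. -}

module Defs where

open import Level using (Level; _⊔_)
open import Data.Nat using (ℕ)
open import Data.Bool using (Bool; true)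
open import Data.Fin using (Fin)
open import Data.Fin.Subset using (Subset; _∈_; _⊆_; _∩_)
open import Data.Product using (Σ; ∃; _×_; _,_; proj₁; proj₂)
open import Function using (_∘_; _⇔_)
open import Relation.Binary.PropositionalEquality using (_≡_)
open import Relation.Binary.Lattice.Bundles using (Lattice)

-- A finite arc-colored digraph: vertex set Fin n, colour set Fin k,
-- arc sets A c ⊆ V × V given by their (decidable) characteristic functions.
record Digraph : Set where
  field
    n : ℕ
    k : ℕ
    A : Fin k → Fin n → Fin n → Bool

module _ (D : Digraph) where
  open Digraph D

  Vertex : Set
  Vertex = Fin n

  IsEndo : (Vertex → Vertex) → Set
  IsEndo φ = ∀ c u v → A c u v ≡ true → A c (φ u) (φ v) ≡ true

  End : Set
  End = Σ (Vertex → Vertex) IsEndo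

  _≈E_ : End → End → Set
  φ ≈E ψ = ∀ x → proj₁ φ x ≡ proj₁ ψ x

  _∘E_ : End → End → End
  (φ , pφ) ∘E (ψ , pψ) = (φ ∘ ψ) , (λ c u v a → pφ c (ψ u) (ψ v) (pψ c u v a))

  IsRetraction : End → Set
  IsRetraction (r , _) = ∀ x → r (r x) ≡ r x

  -- A retract is the subgraph induced by the image of a retraction; being an
  -- induced subgraph it is determined by its vertex set S ⊆ V, and inclusion
  -- of induced subgraphs is inclusion of vertex sets.
  IsRetract : Subset n → Set
  IsRetract S = Σ End λ r → IsRetraction r ×
                  (∀ x → (x ∈ S) ⇔ (∃ λ y → proj₁ r y ≡ x))

  Retract : Set
  Retract = Σ (Subset n) IsRetract

module _ {c ℓ₁ ℓ₂ : Level} (L : Lattice c ℓ₁ ℓ₂) where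
  open Lattice L

  IsFiniteLattice : Set (c ⊔ ℓ₁)
  IsFiniteLattice = Σ ℕ λ m → Σ (Carrier → Fin m) λ to → Σ (Fin m → Carrier) λ from →
                      (∀ x → from (to x) ≈ x) × (∀ i → to (from i) ≡ i)

  -- A monoid isomorphism End(D) ≅ (L, ∧): a bijection (up to the respective
  -- equalities) that turns composition into meet.  (Preservation of the
  -- identity is automatic for a surjective homomorphism.)
  record EndIsoMeet (D : Digraph) : Set (c ⊔ ℓ₁) where
    field
      to      : End D → Carrier
      from    : Carrier → End D
      to-cong   : ∀ {φ ψ} → _≈E_ D φ ψ → to φ ≈ to ψ
      from-cong : ∀ {a b} → a ≈ b → _≈E_ D (from a) (from b)
      to-from : ∀ a → to (from a) ≈ a
      from-to : ∀ φ → _≈E_ D (from (to φ)) φ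
      homo    : ∀ φ ψ → to (_∘E_ D φ ψ) ≈ (to φ ∧ to ψ)

-- Since End(D) ≅ (L, ∧) and every element of a semilattice is idempotent, each
-- a ∈ L corresponds to an idempotent endomorphism e_a, i.e. a retraction, and
-- these retractions commute.  For commuting idempotents the image of e_a ∘ e_b
-- is im e_a ∩ im e_b, and im e_a ⊆ im e_b iff e_b ∘ e_a = e_a, i.e. b ∧ a = a.
-- Every retraction r is e_(to r), so a ↦ im e_a hits every retract.
module Submission where

open import Defs
open import Level using (Level)
open import Data.Nat using (ℕ)
open import Data.Bool.Properties using (T-≡)
open import Data.Fin using (Fin; _≟_)
open import Data.Fin.Properties using (any?)
open import Data.Fin.Subset using (Subset; _∈_; _⊆_; _∩_)
open import Data.Fin.Subset.Properties using (⊆-antisym; x∈p∩q⁺; x∈p∩q⁻)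
open import Data.Product using (Σ; ∃; _×_; _,_; proj₁)
open import Data.Vec using (tabulate)
open import Data.Vec.Properties using (lookup⇒[]=; []=⇒lookup; lookup∘tabulate)
open import Function using (_∘_; _⇔_; mk⇔; Equivalence)
open import Relation.Binary.PropositionalEquality using (_≡_; _≗_; refl; sym; trans; cong)
open import Relation.Binary.Lattice.Bundles using (Lattice)
open import Relation.Nullary.Decidable using (isYes; fromWitness; toWitness)
import Relation.Binary.Lattice.Properties.MeetSemilattice as MeetSemilatticeProperties

module _ {n : ℕ} where

  image : (Fin n → Fin n) → Subset n
  image f = tabulate λ x → isYes (any? λ y → f y ≟ x)

  ∈-image⁺ : ∀ f {x} y → f y ≡ x → x ∈ image f
  ∈-image⁺ f {x} y fy≡x =
    lookup⇒[]= x (image f) (trans (lookup∘tabulate _ x) (Equivalence.to T-≡ (fromWitness (y , fy≡x))))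

  ∈-image⁻ : ∀ f {x} → x ∈ image f → ∃ λ y → f y ≡ x
  ∈-image⁻ f {x} x∈ =
    toWitness {a? = any? λ y → f y ≟ x} (Equivalence.from T-≡ (trans (sym (lookup∘tabulate _ x)) ([]=⇒lookup x∈)))

  ≡-image : ∀ {S f} → (∀ x → x ∈ S ⇔ (∃ λ y → f y ≡ x)) → S ≡ image f
  ≡-image {S} {f} S⇔im = ⊆-antisym S⊆im im⊆S
    where
    S⊆im : S ⊆ image f
    S⊆im {x} x∈S = let (y , fy≡x) = Equivalence.to (S⇔im x) x∈S in ∈-image⁺ f y fy≡x
    im⊆S : image f ⊆ S
    im⊆S {x} x∈im = Equivalence.from (S⇔im x) (∈-image⁻ f x∈im)

  image-cong : ∀ {f g} → f ≗ g → image f ≡ image g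
  image-cong {f} {g} f≗g = ≡-image λ x →
    mk⇔ (λ x∈ → let (y , fy≡x) = ∈-image⁻ f x∈ in y , trans (sym (f≗g y)) fy≡x)
        (λ (y , gy≡x) → ∈-image⁺ f y (trans (f≗g y) gy≡x))

  Idempotent : (Fin n → Fin n) → Set
  Idempotent f = ∀ x → f (f x) ≡ f x

  idempotent⇒fixes-image : ∀ {f x} → Idempotent f → x ∈ image f → f x ≡ x
  idempotent⇒fixes-image {f} idem x∈ with ∈-image⁻ f x∈
  ... | y , refl = idem y

  image⊆image⇔absorb : ∀ {f g} → Idempotent g → image f ⊆ image g ⇔ (g ∘ f ≗ f)
  image⊆image⇔absorb {f} {g} idem-g = mk⇔ absorb image⊆
    where
    absorb : image f ⊆ image g → g ∘ f ≗ f
    absorb im⊆ y = idempotent⇒fixes-image idem-g (im⊆ (∈-image⁺ f y refl))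
    image⊆ : g ∘ f ≗ f → image f ⊆ image g
    image⊆ gf≗f x∈ with ∈-image⁻ f x∈
    ... | y , refl = ∈-image⁺ g (f y) (gf≗f y)

  image-∘-commuting : ∀ {f g} → Idempotent f → Idempotent g → f ∘ g ≗ g ∘ f →
                      image (f ∘ g) ≡ image f ∩ image g
  image-∘-commuting {f} {g} idem-f idem-g comm = ⊆-antisym im∘⊆∩ ∩⊆im∘
    where
    im∘⊆∩ : image (f ∘ g) ⊆ image f ∩ image g
    im∘⊆∩ x∈ with ∈-image⁻ (f ∘ g) x∈
    ... | y , refl = x∈p∩q⁺ (∈-image⁺ f (g y) refl , ∈-image⁺ g (f y) (sym (comm y)))
    ∩⊆im∘ : image f ∩ image g ⊆ image (f ∘ g)
    ∩⊆im∘ {x} x∈ = let (x∈f , x∈g) = x∈p∩q⁻ (image f) (image g) x∈ in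
      ∈-image⁺ (f ∘ g) x
        (trans (cong f (idempotent⇒fixes-image idem-g x∈g)) (idempotent⇒fixes-image idem-f x∈f))

module _ {c ℓ₁ ℓ₂ : Level} (L : Lattice c ℓ₁ ℓ₂) (D : Digraph) (iso : EndIsoMeet L D) where
  open Lattice L hiding (refl) renaming (trans to ≤-trans; reflexive to ≤-reflexive)
  open MeetSemilatticeProperties meetSemilattice using (∧-comm; ∧-cong; ∧-idempotent; y≤x⇒x∧y≈y)
  open EndIsoMeet iso
  open Digraph D using (n)

  endo : Carrier → Fin n → Fin n
  endo a = proj₁ (from a)

  endo-∧ : ∀ a b → endo a ∘ endo b ≗ endo (a ∧ b)
  endo-∧ a b x = trans (sym (from-to (_∘E_ D (from a) (from b)) x))
    (from-cong (Eq.trans (homo (from a) (from b)) (∧-cong (to-from a) (to-from b))) x)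

  endo-injective : ∀ {a b} → endo a ≗ endo b → a ≈ b
  endo-injective {a} {b} ea≗eb = Eq.trans (Eq.sym (to-from a)) (Eq.trans (to-cong ea≗eb) (to-from b))

  endo-idempotent : ∀ a → Idempotent (endo a)
  endo-idempotent a x = trans (endo-∧ a a x) (from-cong (∧-idempotent a) x)

  endo-commute : ∀ a b → endo a ∘ endo b ≗ endo b ∘ endo a
  endo-commute a b x = trans (endo-∧ a b x) (trans (from-cong (∧-comm a b) x) (sym (endo-∧ b a x)))

  retractOf : Carrier → Retract D
  retractOf a = image (endo a) , from a , endo-idempotent a ,
    λ x → mk⇔ (∈-image⁻ (endo a)) (λ (y , e) → ∈-image⁺ (endo a) y e)

  ≤⇔image⊆ : ∀ a b → a ≤ b ⇔ image (endo a) ⊆ image (endo b)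
  ≤⇔image⊆ a b = mk⇔ (image⊆ ∘ ≤⇒absorb) (absorb⇒≤ ∘ Equivalence.to absorb⇔)
    where
    absorb⇔ : image (endo a) ⊆ image (endo b) ⇔ (endo b ∘ endo a ≗ endo a)
    absorb⇔ = image⊆image⇔absorb (endo-idempotent b)
    image⊆ : endo b ∘ endo a ≗ endo a → image (endo a) ⊆ image (endo b)
    image⊆ = Equivalence.from absorb⇔
    ≤⇒absorb : a ≤ b → endo b ∘ endo a ≗ endo a
    ≤⇒absorb a≤b x = trans (endo-∧ b a x) (from-cong (y≤x⇒x∧y≈y a≤b) x)
    absorb⇒≤ : endo b ∘ endo a ≗ endo a → a ≤ b
    absorb⇒≤ ba≗a = ≤-trans (≤-reflexive (Eq.sym b∧a≈a)) (x∧y≤x b a)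
      where
      b∧a≈a : b ∧ a ≈ a
      b∧a≈a = endo-injective λ x → trans (sym (endo-∧ b a x)) (ba≗a x)

  retractOf-surjective : ∀ (R : Retract D) → ∃ λ a → image (endo a) ≡ proj₁ R
  retractOf-surjective (S , r , _ , S⇔im) = to r , sym (trans (≡-image S⇔im) (image-cong (sym ∘ from-to r)))

  image-∧ : ∀ a b → image (endo (a ∧ b)) ≡ image (endo a) ∩ image (endo b)
  image-∧ a b = trans (image-cong (sym ∘ endo-∧ a b))
    (image-∘-commuting (endo-idempotent a) (endo-idempotent b) (endo-commute a b))

-- The finiteness hypothesis is unused: it already follows from End(D) ≅ L.
lemma11 : {c ℓ₁ ℓ₂ : Level} (L : Lattice c ℓ₁ ℓ₂) (D : Digraph) →
    IsFiniteLattice L → EndIsoMeet L D →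
    Σ (Lattice.Carrier L → Retract D) λ f →
    (∀ a b → (Lattice._≤_ L a b) ⇔ (proj₁ (f a) ⊆ proj₁ (f b)))
    × (∀ (R : Retract D) → ∃ λ a → proj₁ (f a) ≡ proj₁ R)
    × (∀ a b → proj₁ (f (Lattice._∧_ L a b)) ≡ proj₁ (f a) ∩ proj₁ (f b))
lemma11 L D _ iso =
  retractOf L D iso , ≤⇔image⊆ L D iso , retractOf-surjective L D iso , image-∧ L D iso
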